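{- Let $n$ be sufficiently large and let $k,l$ be integers with $2 \leqslant k < n-l < n$. If $l \geqslant 2k+1$, then $\langle r_n, r_{n-l}, r_k\rangle$ is a proper subgroup of $\mathrm{Sym}_n$.
   Context: $\mathrm{Sym}_n$ is the symmetric group acting naturally on $\{1,\dots,n\}$. For $1< i\leqslant n$, the prefix reversal $r_i\in\mathrm{Sym}_n$ is the permutation with $r_i(j)=i+1-j$ for $1\leqslant j\leqslant i$ and $r_i(j)=j$ for $i<j\leqslant n$ (it reverses the order of the first $i$ positions and fixes the rest). -}

module Defs where

open import Data.Nat using (ℕ; zero; suc; _∸_; _<?_)
open import Data.Fin using (Fin; toℕ; fromℕ<)
open import Data.List using (List)
open import Data.List.Membership.Propositional using (_∈_)
open import Relation.Nullary using (yes; no)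
open import Relation.Binary.PropositionalEquality using (_≡_)
open import Data.Fin.Permutation using (Permutation′; _⟨$⟩ʳ_)
open import Data.Product using (∃-syntax)
open import Relation.Nullary using (¬_)
open import Function using (id; _∘_)

-- Prefix reversal r_i on {0,…,n-1} (0-indexed positions):
-- position j with j < i goes to i-1-j, positions j ≥ i are fixed.
-- (Intended for 1 < i ≤ n; the fallback branch "j" never fires when i ≤ n.)
prefixRev : (n i : ℕ) → Fin n → Fin n
prefixRev n i j with toℕ j <? i
... | no _ = j
... | yes _ with i ∸ suc (toℕ j) <? n
...   | yes p = fromℕ< p
...   | no _ = j

-- The subgroup of Sym_n generated by a list of maps Fin n → Fin n,
-- elements represented as functions, up to pointwise equality.
data Generated {n : ℕ} (gs : List (Fin n → Fin n)) : (Fin n → Fin n) → Set where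
  gen   : ∀ {f} → f ∈ gs → Generated gs f
  ident : Generated gs id
  comp  : ∀ {f g} → Generated gs f → Generated gs g → Generated gs (f ∘ g)
  inv   : ∀ {f g} → Generated gs f → (∀ x → f (g x) ≡ x) → (∀ x → g (f x) ≡ x)
          → Generated gs g
  resp  : ∀ {f g} → (∀ x → f x ≡ g x) → Generated gs f → Generated gs g

ProperInSym : {n : ℕ} → List (Fin n → Fin n) → Set
ProperInSym {n} gs = ∃[ σ ] ¬ Generated gs (_⟨$⟩ʳ_ {n} {n} σ)

{-# OPTIONS --safe #-}
-- Call a position j (counted from 0) high if both j and its mirror image n-1-j have
-- residue at least k modulo l.  A prefix reversal of length i ≡ n (mod l) sends j < i
-- to i-1-j, whose residue is that of n-1-j and whose mirror image n-1-(i-1-j) has the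
-- residue of j; so r_n and r_{n-l} map high positions to high positions.  The reversal
-- r_k only moves positions below k ≤ l, and none of these is high.  Hence the whole
-- generated group preserves the set of high positions.  Since l ≥ 2k+1, one of k and 2k
-- is high while 0 is not, so the transposition of these two is not in the group.
-- This works for every n, so the bound N = 0 suffices.
module Submission where

open import Defs
open import Data.Nat
  using (ℕ; suc; _≤_; _<_; _∸_; _*_; _+_; _%_; _<?_; NonZero; >-nonZero; z≤n; s≤s; z<s)
open import Data.Nat.Properties hiding (_≟_)
open import Data.Nat.DivMod using (m<n⇒m%n≡m; [m+kn]%n≡m%n; %-distribˡ-+)
open import Algebra.Properties.CommutativeSemigroup +-commutativeSemigroup
  using (xy∙z≈xz∙y)
open import Data.Fin using (Fin; toℕ; fromℕ<)
open import Data.Fin.Properties using (toℕ-fromℕ<; _≟_)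
open import Data.Fin.Permutation using (_⟨$⟩ʳ_; transpose)
open import Data.List using (_∷_; [])
open import Data.List.Relation.Unary.All as All using (All; _∷_; [])
open import Data.Product using (∃-syntax; _×_; _,_)
open import Data.Sum using (_⊎_; inj₁; inj₂)
open import Data.Empty using (⊥-elim)
open import Function using (_∘_)
open import Function.Bundles using (_⇔_; mk⇔; Equivalence)
open import Function.Construct.Identity using (⇔-id)
open import Function.Construct.Symmetry using (⇔-sym)
open import Function.Construct.Composition using (_⇔-∘_)
open import Relation.Nullary using (¬_; yes; no)
open import Relation.Nullary.Decidable using (dec-true)
open import Relation.Binary.PropositionalEquality
  using (_≡_; refl; sym; trans; cong; subst; module ≡-Reasoning)

transpose-i↦j : ∀ {n} (i j : Fin n) → transpose i j ⟨$⟩ʳ i ≡ j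
transpose-i↦j i j rewrite dec-true (i ≟ i) refl = refl

module _ {n : ℕ} (P : Fin n → Set) where

  Invariant : (Fin n → Fin n) → Set
  Invariant f = ∀ x → P x ⇔ P (f x)

  ≡⇒P⇔P : ∀ {x y} → x ≡ y → P x ⇔ P y
  ≡⇒P⇔P refl = ⇔-id _

  Generated-invariant : ∀ {gs f} → All Invariant gs → Generated gs f → Invariant f
  Generated-invariant inv-gs (gen f∈gs)        = All.lookup inv-gs f∈gs
  Generated-invariant inv-gs ident x           = ⇔-id _
  Generated-invariant inv-gs (comp {g = g} gf gg) x =
    Generated-invariant inv-gs gf (g x) ⇔-∘ Generated-invariant inv-gs gg x
  Generated-invariant inv-gs (inv {g = g} gf f∘g≗id _) x =
    ⇔-sym (≡⇒P⇔P (f∘g≗id x) ⇔-∘ Generated-invariant inv-gs gf (g x))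
  Generated-invariant inv-gs (resp f≗g gf) x =
    ≡⇒P⇔P (f≗g x) ⇔-∘ Generated-invariant inv-gs gf x

  separated⇒ProperInSym : ∀ {gs x y} → All Invariant gs → P x → ¬ P y → ProperInSym gs
  separated⇒ProperInSym {x = x} {y} inv-gs px ¬py =
    transpose x y , λ gen-xy →
      ¬py (subst P (transpose-i↦j x y)
                 (Equivalence.to (Generated-invariant inv-gs gen-xy x) px))

prefixRev-< : ∀ {n i} (j : Fin n) → toℕ j < i → i ≤ n →
              suc (toℕ j + toℕ (prefixRev n i j)) ≡ i
prefixRev-< {n} {i} j j<i i≤n with toℕ j <? i
... | no j≮i = ⊥-elim (j≮i j<i)
... | yes _ with i ∸ suc (toℕ j) <? n
...   | yes r<n =
  trans (cong (λ r → suc (toℕ j + r)) (toℕ-fromℕ< r<n)) (m+[n∸m]≡n j<i)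
...   | no r≮n = ⊥-elim (r≮n (<-≤-trans (∸-monoʳ-< (s≤s z≤n) j<i) i≤n))

prefixRev-≥ : ∀ {n i} (j : Fin n) → i ≤ toℕ j → prefixRev n i j ≡ j
prefixRev-≥ {n} {i} j i≤j with toℕ j <? i
... | no _    = refl
... | yes j<i = ⊥-elim (<⇒≱ j<i i≤j)

[m+k]%n<k⇒n≤m%n+k : ∀ m {k n} .{{_ : NonZero n}} → k < n → (m + k) % n < k → n ≤ m % n + k
[m+k]%n<k⇒n≤m%n+k m {k} {n} k<n [m+k]%n<k with <-≤-connex (m % n + k) n
... | inj₂ n≤m%n+k = n≤m%n+k
... | inj₁ m%n+k<n = ⊥-elim (<⇒≱ [m+k]%n<k (begin
  k                  ≤⟨ m≤n+m k (m % n) ⟩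
  m % n + k          ≡⟨ m<n⇒m%n≡m m%n+k<n ⟨
  (m % n + k) % n    ≡⟨ cong (λ r → (m % n + r) % n) (m<n⇒m%n≡m k<n) ⟨
  (m % n + k % n) % n ≡⟨ %-distribˡ-+ m k n ⟨
  (m + k) % n        ∎))
  where open ≤-Reasoning

module HighPositions (n l k : ℕ) .{{_ : NonZero l}} where

  High : ℕ → Set
  High j = k ≤ j % l × k ≤ (n ∸ suc j) % l

  mirror-residue : ∀ {a b} q → suc (a + b) + q * l ≡ n → (n ∸ suc b) % l ≡ a % l
  mirror-residue {a} {b} q a+b+1+ql≡n = begin
    (n ∸ suc b) % l               ≡⟨ cong (λ m → (m ∸ suc b) % l) a+b+1+ql≡n ⟨
    (a + b + q * l ∸ b) % l       ≡⟨ cong (λ m → (m ∸ b) % l) (xy∙z≈xz∙y a b (q * l)) ⟩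
    (a + q * l + b ∸ b) % l       ≡⟨ cong (_% l) (m+n∸n≡m (a + q * l) b) ⟩
    (a + q * l) % l               ≡⟨ [m+kn]%n≡m%n a q l ⟩
    a % l                         ∎
    where open ≡-Reasoning

  High-mirror : ∀ {a b} q → suc (a + b) + q * l ≡ n → High a ⇔ High b
  High-mirror {a} {b} q a+b+1+ql≡n = mk⇔ (exchange residue-a residue-b) (exchange residue-b residue-a)
    where
    residue-a : (n ∸ suc b) % l ≡ a % l
    residue-a = mirror-residue q a+b+1+ql≡n
    residue-b : (n ∸ suc a) % l ≡ b % l
    residue-b = mirror-residue q (trans (cong (λ m → suc m + q * l) (+-comm b a)) a+b+1+ql≡n)
    exchange : ∀ {c d} → (n ∸ suc d) % l ≡ c % l → (n ∸ suc c) % l ≡ d % l → High c → High d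
    exchange residue-c residue-d (k≤c , k≤c′) =
      subst (k ≤_) residue-d k≤c′ , subst (k ≤_) (sym residue-c) k≤c

  below⇒¬High : ∀ {j} → k ≤ l → j < k → ¬ High j
  below⇒¬High k≤l j<k (k≤j%l , _) =
    <⇒≱ j<k (subst (k ≤_) (m<n⇒m%n≡m (<-≤-trans j<k k≤l)) k≤j%l)

  prefixRev-mirror-invariant : ∀ i q → i + q * l ≡ n → Invariant (High ∘ toℕ) (prefixRev n i)
  prefixRev-mirror-invariant i q i+ql≡n x with <-≤-connex (toℕ x) i
  ... | inj₁ x<i = High-mirror q (trans (cong (_+ q * l) (prefixRev-< x x<i i≤n)) i+ql≡n)
    where
    i≤n : i ≤ n
    i≤n = subst (i ≤_) i+ql≡n (m≤m+n i (q * l))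
  ... | inj₂ i≤x = ≡⇒P⇔P (High ∘ toℕ) (sym (prefixRev-≥ x i≤x))

  prefixRev-short-invariant : k ≤ l → k ≤ n → Invariant (High ∘ toℕ) (prefixRev n k)
  prefixRev-short-invariant k≤l k≤n x with <-≤-connex (toℕ x) k
  ... | inj₁ x<k = mk⇔ (⊥-elim ∘ below⇒¬High k≤l x<k) (⊥-elim ∘ below⇒¬High k≤l image<k)
    where
    image<k : toℕ (prefixRev n k x) < k
    image<k = subst (toℕ (prefixRev n k x) <_) (prefixRev-< x x<k k≤n)
                    (s≤s (m≤n+m (toℕ (prefixRev n k x)) (toℕ x)))
  ... | inj₂ k≤x = ≡⇒P⇔P (High ∘ toℕ) (sym (prefixRev-≥ x k≤x))

  -- If k is not high, the residue of n-1-k is below k, so that of n-1-2k wraps around past l-k > k.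
  High-witness : k + k < l → l < n → ∃[ x ] x < l × High x
  High-witness 2k<l l<n = witness (<-≤-connex ((n ∸ suc k) % l) k)
    where
    k<l : k < l
    k<l = ≤-<-trans (m≤m+n k k) 2k<l
    s : ℕ
    s = n ∸ suc (k + k)
    k≤n∸[1+k] : k ≤ n ∸ suc k
    k≤n∸[1+k] = m+n≤o⇒m≤o∸n k (subst (_≤ n) (sym (+-suc k k)) (<-trans 2k<l l<n))
    s+k≡n∸[1+k] : s + k ≡ n ∸ suc k
    s+k≡n∸[1+k] = begin
      n ∸ suc (k + k) + k ≡⟨ cong (_+ k) (∸-+-assoc n (suc k) k) ⟨
      n ∸ suc k ∸ k + k   ≡⟨ m∸n+n≡m k≤n∸[1+k] ⟩
      n ∸ suc k           ∎
      where open ≡-Reasoning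
    witness : (n ∸ suc k) % l < k ⊎ k ≤ (n ∸ suc k) % l → ∃[ x ] x < l × High x
    witness (inj₂ k≤r) = k , k<l , subst (k ≤_) (sym (m<n⇒m%n≡m k<l)) ≤-refl , k≤r
    witness (inj₁ r<k) = k + k , 2k<l , subst (k ≤_) (sym (m<n⇒m%n≡m 2k<l)) (m≤m+n k k) , <⇒≤ k<s%l
      where
      l≤s%l+k : l ≤ s % l + k
      l≤s%l+k = [m+k]%n<k⇒n≤m%n+k s k<l (subst (λ m → m % l < k) (sym s+k≡n∸[1+k]) r<k)
      k<s%l : k < s % l
      k<s%l = +-cancelʳ-< k k (s % l) (<-≤-trans 2k<l l≤s%l+k)

prefixRevs-proper : ∀ {n} k l → 0 < k → k + k < l → l < n →
                    ProperInSym (prefixRev n n ∷ prefixRev n (n ∸ l) ∷ prefixRev n k ∷ [])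
prefixRevs-proper {n} k l 0<k 2k<l l<n = from-witness (High-witness 2k<l l<n)
  where
  instance
    l≢0 : NonZero l
    l≢0 = >-nonZero (≤-<-trans z≤n 2k<l)
  open HighPositions n l k
  k≤l : k ≤ l
  k≤l = ≤-trans (m≤m+n k k) (<⇒≤ 2k<l)
  invariant : All (Invariant (High ∘ toℕ)) (prefixRev n n ∷ prefixRev n (n ∸ l) ∷ prefixRev n k ∷ [])
  invariant = prefixRev-mirror-invariant n 0 (+-identityʳ n)
            ∷ prefixRev-mirror-invariant (n ∸ l) 1
                (trans (cong (n ∸ l +_) (+-identityʳ l)) (m∸n+n≡m (<⇒≤ l<n)))
            ∷ prefixRev-short-invariant k≤l (≤-trans k≤l (<⇒≤ l<n))
            ∷ []
  0<n : 0 < n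
  0<n = ≤-<-trans z≤n l<n
  ¬High-0 : ¬ High (toℕ (fromℕ< 0<n))
  ¬High-0 = below⇒¬High k≤l 0<k ∘ subst High (toℕ-fromℕ< 0<n)
  from-witness : ∃[ x ] x < l × High x →
                 ProperInSym (prefixRev n n ∷ prefixRev n (n ∸ l) ∷ prefixRev n k ∷ [])
  from-witness (x , x<l , high-x) =
    separated⇒ProperInSym (High ∘ toℕ) invariant
      (subst High (sym (toℕ-fromℕ< (<-trans x<l l<n))) high-x) ¬High-0

mainTheorem1 : ∃[ N ] ∀ (n k l : ℕ) → N ≤ n → 2 ≤ k → k < n ∸ l → n ∸ l < n
                 → 2 * k + 1 ≤ l
                 → ProperInSym (prefixRev n n ∷ prefixRev n (n ∸ l) ∷ prefixRev n k ∷ [])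
mainTheorem1 = 0 , λ n k l _ 2≤k k<n∸l _ 2k+1≤l →
  prefixRevs-proper k l (<-≤-trans z<s 2≤k)
    (subst (_≤ l) (trans (+-comm (2 * k) 1) (cong (λ m → suc (k + m)) (+-identityʳ k))) 2k+1≤l)
    (m∸n≢0⇒n<m (λ n∸l≡0 → n≮0 (subst (k <_) n∸l≡0 k<n∸l)))
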